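{- Let $G$ be a connected graph that contains an induced paw, and let $uv$ be an edge of $G$. Then every set $E_+$ of non-edges of $G$ such that $G+E_+$ is paw-free contains at least $|V(G)\setminus N[\{u,v\}]|$ edges incident to $u$ or $v$.
   Context: All graphs are finite, simple and undirected. A paw is the four-vertex graph consisting of a triangle together with one additional vertex adjacent to exactly one vertex of the triangle; a graph is paw-free if it has no induced paw. $G+E_+$ is the graph on $V(G)$ with edge set $E(G)\cup E_+$. $N[\{u,v\}]=N[u]\cup N[v]$, where $N[x]$ is the closed neighborhood of $x$. -}

module Defs where

open import Data.Nat using (ℕ; _<_)
open import Data.Fin using (Fin; toℕ) public
open import Data.Fin.Properties using (_≟_)
open import Data.Bool using (Bool; true; false; _∨_; _∧_; not; if_then_else_)
open import Data.List using (List; []; _∷_; length; filter; map; concatMap; allFin)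
open import Data.Product using (_×_; _,_; Σ; ∃; proj₁; proj₂)
open import Relation.Binary.PropositionalEquality using (_≡_)
open import Relation.Nullary using (¬_; does)
open import Relation.Nullary.Decidable using (⌊_⌋)
open import Data.Nat.Properties using (_<?_)

record Graph : Set where
  field
    n      : ℕ
    adj    : Fin n → Fin n → Bool
    sym    : ∀ x y → adj x y ≡ adj y x
    irrefl : ∀ x → adj x x ≡ false
open Graph public

_~[_]_ : ∀ {n} → Fin n → (Fin n → Fin n → Bool) → Fin n → Set
x ~[ a ] y = a x y ≡ true

data Reach {n : ℕ} (a : Fin n → Fin n → Bool) : Fin n → Fin n → Set where
  here : ∀ {x} → Reach a x x
  step : ∀ {x y z} → a x y ≡ true → Reach a y z → Reach a x z

Connected : Graph → Set
Connected G = ∀ x y → Reach (adj G) x y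

record InducedPaw {n : ℕ} (a : Fin n → Fin n → Bool) : Set where
  field
    p q r s : Fin n
    pq : ¬ p ≡ q
    pr : ¬ p ≡ r
    ps : ¬ p ≡ s
    qr : ¬ q ≡ r
    qs : ¬ q ≡ s
    rs : ¬ r ≡ s
    e-pq : a p q ≡ true
    e-pr : a p r ≡ true
    e-qr : a q r ≡ true
    e-rs : a r s ≡ true
    n-ps : a p s ≡ false
    n-qs : a q s ≡ false

PawFree : ∀ {n} → (Fin n → Fin n → Bool) → Set
PawFree a = ¬ InducedPaw a

record NonEdgeSet (G : Graph) : Set where
  field
    add        : Fin (n G) → Fin (n G) → Bool
    add-sym    : ∀ x y → add x y ≡ add y x
    add-irrefl : ∀ x → add x x ≡ false
    add-non    : ∀ x y → add x y ≡ true → adj G x y ≡ false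
open NonEdgeSet public

plus : (G : Graph) → NonEdgeSet G → Fin (n G) → Fin (n G) → Bool
plus G E x y = adj G x y ∨ add E x y

-- All unordered pairs {x,y} (represented with toℕ x < toℕ y).
pairs : (m : ℕ) → List (Fin m × Fin m)
pairs m = concatMap (λ x → map (λ y → x , y) (filter (λ y → toℕ x <? toℕ y) (allFin m))) (allFin m)

_==_ : ∀ {m} → Fin m → Fin m → Bool
x == y = ⌊ x ≟ y ⌋

incidentCount : (G : Graph) → NonEdgeSet G → Fin (n G) → Fin (n G) → ℕ
incidentCount G E u v =
  length (filter (λ e → add E (proj₁ e) (proj₂ e) ∧
                          ((proj₁ e == u) ∨ (proj₁ e == v) ∨ (proj₂ e == u) ∨ (proj₂ e == v))
                   Data.Bool.≟ true)
                 (pairs (n G)))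

outsideCount : (G : Graph) → Fin (n G) → Fin (n G) → ℕ
outsideCount G u v =
  length (filter (λ w → not ((w == u) ∨ (w == v) ∨ adj G u w ∨ adj G v w) Data.Bool.≟ true)
                 (allFin (n G)))

-- In a paw-free graph, a vertex adjacent to one corner of a triangle is adjacent to
-- another corner.  Hence lying on a triangle propagates along edges, so in the
-- connected paw-free graph G + E₊ (which keeps the triangle of the paw of G) every
-- vertex lies on a triangle, and then N(u) ∪ N(v) is closed under taking neighbours
-- for every edge uv: the edge uv dominates G + E₊.  A vertex w outside N_G[{u,v}] is
-- therefore joined to u or v by an added edge, and w ↦ that edge is injective.
module Submission where

open import Defs
open import Data.Nat using (_≤_)
open import Relation.Binary.PropositionalEquality using (_≡_)
open import Data.Bool using (true)

open import Data.Nat using (suc; z≤n; s≤s; _<_)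
open import Data.Nat.Properties using (module ≤-Reasoning; _<?_)
open import Data.Bool using (Bool; false; _∨_; _∧_; not; if_then_else_)
open import Data.Bool.Properties using (∨-assoc; ∨-zeroʳ; ∨-conicalˡ; ∨-conicalʳ; not-¬; not-injective)
import Data.Bool as Bool
open import Data.Fin.Properties using (<-cmp; _≟_)
open import Data.List using (List; []; _∷_; length; filter; allFin)
open import Data.List.Properties using (length-removeAt′)
open import Data.List.Membership.Propositional using (_∈_; lose)
open import Data.List.Membership.Propositional.Properties
  using (∈-filter⁺; ∈-filter⁻; ∈-concatMap⁺; ∈-map⁺; ∈-allFin)
open import Data.List.Relation.Unary.Any using (here; there; index; _─_)
open import Data.List.Relation.Unary.All using (lookup)
open import Data.List.Relation.Unary.AllPairs using (_∷_)
open import Data.List.Relation.Unary.Unique.Propositional using (Unique)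
open import Data.List.Relation.Unary.Unique.Propositional.Properties using (allFin⁺; filter⁺)
open import Data.Product using (_×_; _,_; ∃; ∃₂; proj₁; proj₂)
open import Data.Sum using (_⊎_; inj₁; inj₂; swap) renaming (map to ⊎-map)
open import Data.Empty using (⊥-elim)
open import Relation.Nullary.Decidable using (dec-true; isYes≗does)
open import Relation.Binary.Definitions using (tri<; tri≈; tri>)
open import Relation.Binary.PropositionalEquality
  using (refl; trans; cong; cong₂; _≢_)
import Relation.Binary.PropositionalEquality as ≡

∈-─ : ∀ {A : Set} {x y : A} {ys : List A} (x∈ys : x ∈ ys) →
      y ∈ ys → y ≢ x → y ∈ (ys ─ x∈ys)
∈-─ (here refl)  (here refl)  y≢x = ⊥-elim (y≢x refl)
∈-─ (here refl)  (there y∈ys) _   = y∈ys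
∈-─ (there x∈ys) (here refl)  _   = here refl
∈-─ (there x∈ys) (there y∈ys) y≢x = there (∈-─ x∈ys y∈ys y≢x)

length-≤-injectiveOn : ∀ {A B : Set} (f : A → B) {xs : List A} {ys : List B} →
  Unique xs → (∀ {x} → x ∈ xs → f x ∈ ys) →
  (∀ {x y} → x ∈ xs → y ∈ xs → f x ≡ f y → x ≡ y) →
  length xs ≤ length ys
length-≤-injectiveOn f {[]}     _              _    _   = z≤n
length-≤-injectiveOn f {x ∷ xs} {ys} (x∉xs ∷ xs!) into inj = begin
  suc (length xs)           ≤⟨ s≤s (length-≤-injectiveOn f xs! into′ inj′) ⟩
  suc (length (ys ─ fx∈ys)) ≡⟨ ≡.sym (length-removeAt′ ys (index fx∈ys)) ⟩
  length ys                 ∎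
  where
  open ≤-Reasoning
  fx∈ys : f x ∈ ys
  fx∈ys = into (here refl)
  into′ : ∀ {y} → y ∈ xs → f y ∈ (ys ─ fx∈ys)
  into′ y∈xs = ∈-─ fx∈ys (into (there y∈xs))
    λ fy≡fx → lookup x∉xs y∈xs (≡.sym (inj (there y∈xs) (here refl) fy≡fx))
  inj′ : ∀ {y z} → y ∈ xs → z ∈ xs → f y ≡ f z → y ≡ z
  inj′ y∈xs z∈xs = inj (there y∈xs) (there z∈xs)

Reach-mono : ∀ {m} {a b : Fin m → Fin m → Bool} →
  (∀ {x y} → a x y ≡ true → b x y ≡ true) →
  ∀ {x y} → Reach a x y → Reach b x y
Reach-mono a⊆b here         = here
Reach-mono a⊆b (step e xy) = step (a⊆b e) (Reach-mono a⊆b xy)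

module PawFreeGraph (H : Graph) (paw-free : PawFree (adj H)) where

  private
    V : Set
    V = Fin (n H)

  infix 4 _~_
  _~_ : V → V → Set
  x ~ y = x ~[ adj H ] y

  ~-sym : ∀ {x y} → x ~ y → y ~ x
  ~-sym {x} {y} = trans (sym H y x)

  ~-irrefl : ∀ {x y} → x ~ y → x ≢ y
  ~-irrefl {x} xx refl = not-¬ (irrefl H x) xx

  triangle-attach : ∀ {x y z t} → x ~ y → x ~ z → y ~ z → z ~ t → t ~ x ⊎ t ~ y
  triangle-attach {x} {y} {z} {t} xy xz yz zt with adj H t x in tx | adj H t y in ty
  ... | true  | _     = inj₁ refl
  ... | false | true  = inj₂ refl
  ... | false | false = ⊥-elim (paw-free record
    { p = x ; q = y ; r = z ; s = t
    ; pq = ~-irrefl xy ; pr = ~-irrefl xz ; qr = ~-irrefl yz ; rs = ~-irrefl zt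
    ; ps = λ { refl → not-¬ ty xy }
    ; qs = λ { refl → not-¬ tx (~-sym xy) }
    ; e-pq = xy ; e-pr = xz ; e-qr = yz ; e-rs = zt
    ; n-ps = trans (sym H x t) tx ; n-qs = trans (sym H y t) ty })

  InTriangle : V → Set
  InTriangle x = ∃₂ λ a b → x ~ a × x ~ b × a ~ b

  inTriangle-step : ∀ {x y} → InTriangle x → x ~ y → InTriangle y
  inTriangle-step {x} (a , b , xa , xb , ab) xy
    with triangle-attach ab (~-sym xa) (~-sym xb) xy
  ... | inj₁ ya = x , a , ~-sym xy , ya , xa
  ... | inj₂ yb = x , b , ~-sym xy , yb , xb

  inTriangle-reach : ∀ {x y} → InTriangle x → Reach (adj H) x y → InTriangle y
  inTriangle-reach tx here         = tx
  inTriangle-reach tx (step xy yz) = inTriangle-reach (inTriangle-step tx xy) yz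

  common-neighbour : ∀ {u v} → InTriangle u → u ~ v → ∃ λ d → u ~ d × v ~ d
  common-neighbour (a , b , ua , ub , ab) uv
    with triangle-attach ab (~-sym ua) (~-sym ub) uv
  ... | inj₁ va = a , ua , va
  ... | inj₂ vb = b , ub , vb

  -- For a common neighbour d of u and y, the vertex x attaches to the triangle uyd at y,
  -- and v attaches to it at u.
  neighbour-step : ∀ {u v y x} → InTriangle u → u ~ v → u ~ y → y ~ x → u ~ x ⊎ v ~ x
  neighbour-step tu uv uy yx with common-neighbour tu uy
  ... | d , ud , yd with triangle-attach ud uy (~-sym yd) yx
  ...   | inj₁ xu = inj₁ (~-sym xu)
  ...   | inj₂ xd with triangle-attach yd (~-sym uy) (~-sym ud) uv
  ...     | inj₁ vy = ⊎-map ~-sym ~-sym (triangle-attach uv uy vy yx)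
  ...     | inj₂ vd = ⊎-map ~-sym ~-sym (triangle-attach uv ud vd (~-sym xd))

  dominated-reach : ∀ {u v y x} → InTriangle u → InTriangle v → u ~ v →
    u ~ y ⊎ v ~ y → Reach (adj H) y x → u ~ x ⊎ v ~ x
  dominated-reach tu tv uv dy here = dy
  dominated-reach tu tv uv (inj₁ uy) (step yz zx) =
    dominated-reach tu tv uv (neighbour-step tu uv uy yz) zx
  dominated-reach tu tv uv (inj₂ vy) (step yz zx) =
    dominated-reach tu tv uv (swap (neighbour-step tv (~-sym uv) vy yz)) zx

  edge-dominating : Connected H → ∀ {w u v} → InTriangle w → u ~ v → ∀ x → u ~ x ⊎ v ~ x
  edge-dominating connected {w} {u} {v} tw uv x =
    dominated-reach (inTriangle-reach tw (connected w u)) (inTriangle-reach tw (connected w v))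
      uv (inj₂ (~-sym uv)) (connected u x)

_+ᴱ_ : (G : Graph) → NonEdgeSet G → Graph
G +ᴱ E = record
  { n      = n G
  ; adj    = plus G E
  ; sym    = λ x y → cong₂ _∨_ (sym G x y) (add-sym E x y)
  ; irrefl = λ x → cong₂ _∨_ (irrefl G x) (add-irrefl E x)
  }

plus-⊇ : ∀ {G : Graph} (E : NonEdgeSet G) {x y} → adj G x y ≡ true → plus G E x y ≡ true
plus-⊇ E = cong (_∨ _)

plus-added : ∀ {G : Graph} (E : NonEdgeSet G) {x y} →
  adj G x y ≡ false → plus G E x y ≡ true → add E x y ≡ true
plus-added E {x} {y} xy = trans (cong (_∨ add E x y) (≡.sym xy))

+ᴱ-connected : ∀ {G : Graph} (E : NonEdgeSet G) → Connected G → Connected (G +ᴱ E)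
+ᴱ-connected E connected x y = Reach-mono (plus-⊇ E) (connected x y)

sortPair : ∀ {m} → Fin m → Fin m → Fin m × Fin m
sortPair a b with <-cmp a b
... | tri< _ _ _ = a , b
... | tri≈ _ _ _ = a , b
... | tri> _ _ _ = b , a

∈-pairs : ∀ {m} {a b : Fin m} → toℕ a < toℕ b → (a , b) ∈ pairs m
∈-pairs {a = a} {b} a<b = ∈-concatMap⁺ _ (lose (∈-allFin a)
  (∈-map⁺ (a ,_) (∈-filter⁺ (λ c → toℕ a <? toℕ c) (∈-allFin b) a<b)))

module Counting (G : Graph) (E : NonEdgeSet G) (u v : Fin (n G)) where

  private
    V : Set
    V = Fin (n G)

  isEndpoint : V → Bool
  isEndpoint x = (x == u) ∨ (x == v)

  record Outside (w : V) : Set where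
    field
      not-endpoint : isEndpoint w ≡ false
      non-adj-u    : adj G u w ≡ false
      non-adj-v    : adj G v w ≡ false
  open Outside public

  outsideVertices : List V
  outsideVertices =
    filter (λ w → not ((w == u) ∨ (w == v) ∨ adj G u w ∨ adj G v w) Bool.≟ true) (allFin (n G))

  incidentEdges : List (V × V)
  incidentEdges =
    filter (λ e → add E (proj₁ e) (proj₂ e) ∧
                    ((proj₁ e == u) ∨ (proj₁ e == v) ∨ (proj₂ e == u) ∨ (proj₂ e == v))
                  Bool.≟ true)
           (pairs (n G))

  ==-refl : (x : V) → (x == x) ≡ true
  ==-refl x = trans (isYes≗does (x ≟ x)) (dec-true (x ≟ x) refl)

  endpoint-u : isEndpoint u ≡ true
  endpoint-u = cong (_∨ (u == v)) (==-refl u)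

  endpoint-v : isEndpoint v ≡ true
  endpoint-v = trans (cong ((v == u) ∨_) (==-refl v)) (∨-zeroʳ (v == u))

  endpoint-≢ : ∀ {a b} → isEndpoint a ≡ true → isEndpoint b ≡ false → a ≢ b
  endpoint-≢ ea eb refl = not-¬ eb ea

  ∈-outsideVertices⁻ : ∀ {w} → w ∈ outsideVertices → Outside w
  ∈-outsideVertices⁻ {w} w∈ = record
    { not-endpoint = ∨-conicalˡ (isEndpoint w) _ outside
    ; non-adj-u    = ∨-conicalˡ (adj G u w) _ adjacent
    ; non-adj-v    = ∨-conicalʳ _ (adj G v w) adjacent
    }
    where
    outside : isEndpoint w ∨ (adj G u w ∨ adj G v w) ≡ false
    outside = trans (∨-assoc (w == u) (w == v) _)
                    (not-injective (proj₂ (∈-filter⁻ _ {xs = allFin (n G)} w∈)))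
    adjacent : adj G u w ∨ adj G v w ≡ false
    adjacent = ∨-conicalʳ (isEndpoint w) _ outside

  touches-endpoint : ∀ a b → isEndpoint a ≡ true ⊎ isEndpoint b ≡ true →
    ((a == u) ∨ (a == v) ∨ (b == u) ∨ (b == v)) ≡ true
  touches-endpoint a b ea⊎eb =
    trans (≡.sym (∨-assoc (a == u) (a == v) _)) (touches ea⊎eb)
    where
    touches : isEndpoint a ≡ true ⊎ isEndpoint b ≡ true → isEndpoint a ∨ isEndpoint b ≡ true
    touches (inj₁ ea) rewrite ea = refl
    touches (inj₂ eb) rewrite eb = ∨-zeroʳ (isEndpoint a)

  ∈-incidentEdges⁺ : ∀ a b → toℕ a < toℕ b → add E a b ≡ true →
    isEndpoint a ≡ true ⊎ isEndpoint b ≡ true → (a , b) ∈ incidentEdges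
  ∈-incidentEdges⁺ a b a<b ab ea⊎eb =
    ∈-filter⁺ _ (∈-pairs a<b) (trans (cong (_∧ _) ab) (touches-endpoint a b ea⊎eb))

  sortPair-∈-incidentEdges : ∀ a b → isEndpoint a ≡ true → isEndpoint b ≡ false →
    add E a b ≡ true → sortPair a b ∈ incidentEdges
  sortPair-∈-incidentEdges a b ea eb ab with <-cmp a b
  ... | tri< a<b _ _ = ∈-incidentEdges⁺ a b a<b ab (inj₁ ea)
  ... | tri≈ _ a≡b _ = ⊥-elim (endpoint-≢ ea eb a≡b)
  ... | tri> _ _ b<a = ∈-incidentEdges⁺ b a b<a (trans (add-sym E b a) ab) (inj₂ ea)

  -- Recovers w from its added edge, whose other end is u or v.
  otherEnd : V × V → V
  otherEnd (a , b) = if isEndpoint a then b else a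

  otherEnd-sortPair : ∀ a b → isEndpoint a ≡ true → isEndpoint b ≡ false →
    otherEnd (sortPair a b) ≡ b
  otherEnd-sortPair a b ea eb with <-cmp a b
  ... | tri< _ _ _ rewrite ea = refl
  ... | tri≈ _ _ _ rewrite ea = refl
  ... | tri> _ _ _ rewrite eb = refl

  partner : V → V
  partner w = if add E u w then u else v

  partner-spec : ∀ {w} → add E u w ≡ true ⊎ add E v w ≡ true →
    isEndpoint (partner w) ≡ true × add E (partner w) w ≡ true
  partner-spec {w} uw⊎vw with add E u w in uw
  ... | true = endpoint-u , uw
  partner-spec (inj₂ vw) | false = endpoint-v , vw

  outsideCount-≤-incidentCount :
    (∀ {w} → Outside w → add E u w ≡ true ⊎ add E v w ≡ true) →
    outsideCount G u v ≤ incidentCount G E u v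
  outsideCount-≤-incidentCount added =
    length-≤-injectiveOn addedEdge (filter⁺ _ (allFin⁺ (n G))) addedEdge-∈ addedEdge-injective
    where
    addedEdge : V → V × V
    addedEdge w = sortPair (partner w) w

    partner-of : ∀ {w} → w ∈ outsideVertices →
      isEndpoint (partner w) ≡ true × add E (partner w) w ≡ true
    partner-of w∈ = partner-spec (added (∈-outsideVertices⁻ w∈))

    otherEnd-addedEdge : ∀ {w} → w ∈ outsideVertices → otherEnd (addedEdge w) ≡ w
    otherEnd-addedEdge w∈ = otherEnd-sortPair (partner _) _
      (proj₁ (partner-of w∈)) (not-endpoint (∈-outsideVertices⁻ w∈))

    addedEdge-∈ : ∀ {w} → w ∈ outsideVertices → addedEdge w ∈ incidentEdges
    addedEdge-∈ w∈ = sortPair-∈-incidentEdges (partner _) _ (proj₁ (partner-of w∈))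
      (not-endpoint (∈-outsideVertices⁻ w∈)) (proj₂ (partner-of w∈))

    addedEdge-injective : ∀ {w w′} → w ∈ outsideVertices → w′ ∈ outsideVertices →
      addedEdge w ≡ addedEdge w′ → w ≡ w′
    addedEdge-injective {w} {w′} w∈ w′∈ eq = begin
      w                      ≡⟨ ≡.sym (otherEnd-addedEdge w∈) ⟩
      otherEnd (addedEdge w)  ≡⟨ cong otherEnd eq ⟩
      otherEnd (addedEdge w′) ≡⟨ otherEnd-addedEdge w′∈ ⟩
      w′                     ∎
      where open ≡.≡-Reasoning

lemma10 : (G : Graph) → Connected G → InducedPaw (adj G) →
    (u v : Fin (n G)) → adj G u v ≡ true →
    (E : NonEdgeSet G) → PawFree (plus G E) →
    outsideCount G u v ≤ incidentCount G E u v
lemma10 G connected paw u v uv E paw-free = outsideCount-≤-incidentCount added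
  where
  open Counting G E u v
  open PawFreeGraph (G +ᴱ E) paw-free
  open InducedPaw paw

  pawTriangle : InTriangle p
  pawTriangle = q , r , plus-⊇ E e-pq , plus-⊇ E e-pr , plus-⊇ E e-qr

  added : ∀ {w} → Outside w → add E u w ≡ true ⊎ add E v w ≡ true
  added {w} out =
    ⊎-map (plus-added E (non-adj-u out)) (plus-added E (non-adj-v out))
      (edge-dominating (+ᴱ-connected E connected) pawTriangle (plus-⊇ E uv) w)
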